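{- In any hypergraph, every weak cycle includes a cycle: some (not necessarily contiguous) subsequence of a weak cycle is a cycle. Consequently, a hypergraph without any cycles has no weak cycles.
   Context: A hypergraph is a pair $H=(U,T)$ with $U$ a finite nonempty vertex set and $T$ a collection of 3-element subsets of $U$ (hyperedges). Vertices $x,y$ are adjacent if there is a hyperedge $\{x,y,z\}$ (so $x,y,z$ are distinct). A sequence $x_1,\dots,x_k$ of $k\geq3$ distinct vertices, indexed modulo $k$, is a weak cycle of length $k$ if each $x_i$ is adjacent to $x_{i+1}$, and either $k>3$ or $k=3$ and $\{x_1,x_2,x_3\}$ is not a hyperedge. A weak cycle $x_1,\dots,x_k$ ($k\ge 3$) is a cycle of length $k$ if no triple $\{x_i,x_{i+1},x_{i+2}\}$ (indices mod $k$) is a hyperedge. A sequence $x_1,x_2$ of two vertices is a cycle of length 2 if there are distinct vertices $y_1,y_2$, different from $x_1,x_2$, such that $\{x_1,x_2,y_1\}$ and $\{x_1,x_2,y_2\}$ are hyperedges. -}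

module Defs where

open import Data.Nat using (ℕ; suc; zero; _≤_)
open import Data.Fin using (Fin; toℕ; _<_)
open import Data.Product using (_×_; _,_; Σ; ∃; ∃-syntax)
open import Data.Sum using (_⊎_)
open import Data.List using (List)
open import Data.List.Relation.Unary.All using (All)
open import Data.List.Relation.Unary.Any using (Any)
open import Relation.Binary.PropositionalEquality using (_≡_; _≢_)
open import Relation.Nullary using (¬_)
open import Function.Definitions using (Injective)

Distinct3 : {A : Set} → A × A × A → Set
Distinct3 (a , b , c) = (a ≢ b) × (b ≢ c) × (a ≢ c)

_∈₃_ : {A : Set} → A → A × A × A → Set
v ∈₃ (a , b , c) = (v ≡ a) ⊎ (v ≡ b) ⊎ (v ≡ c)

-- A hypergraph: vertex set Fin (suc m) (finite, nonempty), and a finite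
-- collection of 3-element subsets, each given as a triple of distinct vertices.
record Hypergraph : Set where
  field
    m        : ℕ
    edges    : List (Fin (suc m) × Fin (suc m) × Fin (suc m))
    distinct : All Distinct3 edges

  V : Set
  V = Fin (suc m)

open Hypergraph public

IsEdge : (H : Hypergraph) → V H → V H → V H → Set
IsEdge H x y z =
  Distinct3 (x , y , z) ×
  Any (λ t → (x ∈₃ t) × (y ∈₃ t) × (z ∈₃ t)) (edges H)

Adjacent : (H : Hypergraph) → V H → V H → Set
Adjacent H x y = ∃[ z ] IsEdge H x y z

CSucc : (k : ℕ) → Fin k → Fin k → Set
CSucc k i j = (suc (toℕ i) ≡ toℕ j) ⊎ ((suc (toℕ i) ≡ k) × (toℕ j ≡ 0))

WeakCycle : (H : Hypergraph) (k : ℕ) → (Fin k → V H) → Set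
WeakCycle H k x =
  (3 ≤ k) ×
  Injective _≡_ _≡_ x ×
  (∀ i j → CSucc k i j → Adjacent H (x i) (x j)) ×
  (k ≡ 3 → ∀ i j l → toℕ i ≡ 0 → toℕ j ≡ 1 → toℕ l ≡ 2 →
     ¬ IsEdge H (x i) (x j) (x l))

Cycle : (H : Hypergraph) (k : ℕ) → (Fin k → V H) → Set
Cycle H k x =
  (WeakCycle H k x ×
    (∀ i j l → CSucc k i j → CSucc k j l → ¬ IsEdge H (x i) (x j) (x l)))
  ⊎
  ((k ≡ 2) × Injective _≡_ _≡_ x ×
    (∀ i j → toℕ i ≡ 0 → toℕ j ≡ 1 →
      ∃[ y₁ ] ∃[ y₂ ] (y₁ ≢ y₂) ×
        (y₁ ≢ x i) × (y₁ ≢ x j) × (y₂ ≢ x i) × (y₂ ≢ x j) ×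
        IsEdge H (x i) (x j) y₁ × IsEdge H (x i) (x j) y₂))

StrictlyIncreasing : {j k : ℕ} → (Fin j → Fin k) → Set
StrictlyIncreasing g = ∀ a b → a < b → g a < g b

-- If no three consecutive vertices of a weak cycle form a hyperedge, it is a cycle.
-- Otherwise some vertex d forms a hyperedge with its two neighbours, which therefore
-- stay adjacent when d is deleted; the remaining subsequence is a shorter weak cycle,
-- and we conclude by induction on the length. Deleting d fails only for length 4, when
-- the three remaining vertices form a hyperedge: then the two neighbours of d lie in
-- two distinct hyperedges and form a cycle of length 2. A weak cycle of length 3 is a
-- cycle, since each of its consecutive triples is the non-edge {x₁, x₂, x₃}.

module Submission where

open import Defs
open import Data.Nat as ℕ using (ℕ; zero; suc; z≤n; s≤s)
open import Data.Nat.Properties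
  using (<-irrefl; ≤-antisym; ≤-pred; ≤-refl; <⇒≤; ≮⇒≥; suc-injective)
open import Data.Fin using (Fin; zero; suc; toℕ; punchIn; _≟_; _<_)
open import Data.Fin.Patterns using (0F; 1F; 2F; 3F)
open import Data.Fin.Properties using (toℕ-injective; toℕ<n; <-cmp; any?)
open import Data.Product using (_×_; _,_; ∃; ∃-syntax)
open import Data.Sum using (_⊎_; inj₁; inj₂)
open import Data.Empty using (⊥-elim)
open import Data.List.Relation.Unary.Any as Any using ()
open import Relation.Nullary using (¬_; Dec; yes; no)
open import Relation.Nullary.Decidable using (_×-dec_; _⊎-dec_; ¬?)
open import Relation.Binary using (tri<; tri≈; tri>)
open import Relation.Binary.PropositionalEquality
  using (_≡_; _≢_; refl; sym; trans; cong; subst; ≢-sym)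
open import Function using (_∘_; id)
open import Function.Definitions using (Injective)
import Function.Construct.Composition as Comp

private
  variable
    k n : ℕ

csucc? : ∀ k (i j : Fin k) → Dec (CSucc k i j)
csucc? k i j = (suc (toℕ i) ℕ.≟ toℕ j) ⊎-dec ((suc (toℕ i) ℕ.≟ k) ×-dec (toℕ j ℕ.≟ 0))

CSucc-functional : {i j j′ : Fin k} → CSucc k i j → CSucc k i j′ → j ≡ j′
CSucc-functional (inj₁ p) (inj₁ q) = toℕ-injective (trans (sym p) q)
CSucc-functional {j = j} (inj₁ p) (inj₂ (s , _)) =
  ⊥-elim (<-irrefl refl (subst (ℕ._< _) (trans (sym p) s) (toℕ<n j)))
CSucc-functional {j′ = j′} (inj₂ (s , _)) (inj₁ q) =
  ⊥-elim (<-irrefl refl (subst (ℕ._< _) (trans (sym q) s) (toℕ<n j′)))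
CSucc-functional (inj₂ (_ , z)) (inj₂ (_ , z′)) = toℕ-injective (trans z (sym z′))

CSucc-injective : {i i′ j : Fin k} → CSucc k i j → CSucc k i′ j → i ≡ i′
CSucc-injective (inj₁ p) (inj₁ q) = toℕ-injective (suc-injective (trans p (sym q)))
CSucc-injective (inj₁ p) (inj₂ (_ , z)) with () ← trans p z
CSucc-injective (inj₂ (_ , z)) (inj₁ q) with () ← trans q z
CSucc-injective (inj₂ (s , _)) (inj₂ (s′ , _)) = toℕ-injective (suc-injective (trans s (sym s′)))

StrictlyIncreasing⇒Injective : {g : Fin k → Fin n} → StrictlyIncreasing g → Injective _≡_ _≡_ g
StrictlyIncreasing⇒Injective {g = g} g-inc {a} {b} ga≡gb with <-cmp a b
... | tri< a<b _ _ = ⊥-elim (<-irrefl (cong toℕ ga≡gb) (g-inc a b a<b))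
... | tri≈ _ a≡b _ = a≡b
... | tri> _ _ b<a = ⊥-elim (<-irrefl (cong toℕ (sym ga≡gb)) (g-inc b a b<a))

punchIn-strictlyIncreasing : (d : Fin (suc n)) → StrictlyIncreasing (punchIn d)
punchIn-strictlyIncreasing zero    _       _       i<j       = s≤s i<j
punchIn-strictlyIncreasing (suc d) zero    (suc j) _         = s≤s z≤n
punchIn-strictlyIncreasing (suc d) (suc i) (suc j) (s≤s i<j) = s≤s (punchIn-strictlyIncreasing d i j i<j)

toℕ-punchIn-< : (d : Fin (suc n)) (i : Fin n) → toℕ i ℕ.< toℕ d → toℕ (punchIn d i) ≡ toℕ i
toℕ-punchIn-< (suc d) zero    _         = refl
toℕ-punchIn-< (suc d) (suc i) (s≤s i<d) = cong suc (toℕ-punchIn-< d i i<d)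

toℕ-punchIn-≥ : (d : Fin (suc n)) (i : Fin n) → toℕ d ℕ.≤ toℕ i → toℕ (punchIn d i) ≡ suc (toℕ i)
toℕ-punchIn-≥ zero    i       _         = refl
toℕ-punchIn-≥ (suc d) (suc i) (s≤s d≤i) = cong suc (toℕ-punchIn-≥ d i d≤i)

CSuccSkipping : Fin (suc n) → Fin (suc n) → Fin (suc n) → Set
CSuccSkipping {n} d i j = CSucc (suc n) i j ⊎ (CSucc (suc n) i d × CSucc (suc n) d j)

CSucc-punchIn : (d : Fin (suc n)) {i j : Fin n} → CSucc n i j →
                CSuccSkipping d (punchIn d i) (punchIn d j)
CSucc-punchIn d {i} {j} (inj₁ p) with ℕ.<-cmp (toℕ j) (toℕ d)
... | tri< j<d _ _ = inj₁ (inj₁ (trans (cong suc (toℕ-punchIn-< d i i<d))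
                                       (trans p (sym (toℕ-punchIn-< d j j<d)))))
  where i<d = <⇒≤ (subst (ℕ._< toℕ d) (sym p) j<d)
... | tri≈ _ j≡d _ = inj₂ (inj₁ (trans (cong suc (toℕ-punchIn-< d i i<d)) (trans p j≡d)) ,
                          inj₁ (trans (cong suc (sym j≡d)) (sym (toℕ-punchIn-≥ d j d≤j))))
  where
  i<d = subst (suc (toℕ i) ℕ.≤_) (trans p j≡d) ≤-refl
  d≤j = subst (ℕ._≤ toℕ j) j≡d ≤-refl
... | tri> _ _ d<j = inj₁ (inj₁ (trans (cong suc (toℕ-punchIn-≥ d i d≤i))
                                       (trans (cong suc p) (sym (toℕ-punchIn-≥ d j (<⇒≤ d<j))))))
  where d≤i = ≤-pred (subst (toℕ d ℕ.<_) (sym p) d<j)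
CSucc-punchIn zero (inj₂ (s , z)) = inj₂ (inj₂ (cong suc s , refl) , inj₁ (cong suc (sym z)))
CSucc-punchIn (suc d) {j = suc j} (inj₂ (_ , ()))
CSucc-punchIn {n} d@(suc _) {i} {zero} (inj₂ (s , refl)) with toℕ i ℕ.<? toℕ d
... | yes i<d = inj₂ (inj₁ (trans (cong suc (toℕ-punchIn-< d i i<d)) (trans s (sym d≡n))) ,
                      inj₂ (cong suc d≡n , refl))
  where
  d≡n : toℕ d ≡ n
  d≡n = ≤-antisym (≤-pred (toℕ<n d)) (subst (ℕ._≤ toℕ d) s i<d)
... | no i≮d = inj₁ (inj₂ (cong suc (trans (toℕ-punchIn-≥ d i (≮⇒≥ i≮d)) s) , refl))

next₃ : Fin 3 → Fin 3
next₃ 0F = 1F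
next₃ 1F = 2F
next₃ 2F = 0F

CSucc-next₃ : ∀ i → CSucc 3 i (next₃ i)
CSucc-next₃ 0F = inj₁ refl
CSucc-next₃ 1F = inj₁ refl
CSucc-next₃ 2F = inj₂ (refl , refl)

pair : Fin k → Fin k → Fin 2 → Fin k
pair i j 0F = i
pair i j 1F = j

pair-strictlyIncreasing : {i j : Fin k} → i < j → StrictlyIncreasing (pair i j)
pair-strictlyIncreasing i<j 0F 1F _        = i<j
pair-strictlyIncreasing i<j 0F 0F ()
pair-strictlyIncreasing i<j 1F 0F ()
pair-strictlyIncreasing i<j 1F 1F (s≤s ())

module _ (H : Hypergraph) where

  IsEdge-rotate : ∀ {a b c} → IsEdge H a b c → IsEdge H b c a
  IsEdge-rotate ((a≢b , b≢c , a≢c) , a,b,c∈t) =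
    (b≢c , ≢-sym a≢c , ≢-sym a≢b) , Any.map (λ (a∈ , b∈ , c∈) → b∈ , c∈ , a∈) a,b,c∈t

  IsEdge-swap : ∀ {a b c} → IsEdge H a b c → IsEdge H b a c
  IsEdge-swap ((a≢b , b≢c , a≢c) , a,b,c∈t) =
    (≢-sym a≢b , a≢c , b≢c) , Any.map (λ (a∈ , b∈ , c∈) → b∈ , a∈ , c∈) a,b,c∈t

  IsEdge-swap₂₃ : ∀ {a b c} → IsEdge H a b c → IsEdge H a c b
  IsEdge-swap₂₃ = IsEdge-rotate ∘ IsEdge-swap

  isEdge? : ∀ a b c → Dec (IsEdge H a b c)
  isEdge? a b c =
    (¬? (a ≟ b) ×-dec ¬? (b ≟ c) ×-dec ¬? (a ≟ c)) ×-dec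
    Any.any? (λ t → ∈₃? a t ×-dec ∈₃? b t ×-dec ∈₃? c t) (edges H)
    where
    ∈₃? : ∀ v (t : V H × V H × V H) → Dec (v ∈₃ t)
    ∈₃? v (a , b , c) = (v ≟ a) ⊎-dec (v ≟ b) ⊎-dec (v ≟ c)

  SubCycle : ∀ k → (Fin k → V H) → Set
  SubCycle k x = ∃[ j ] ∃[ g ] (StrictlyIncreasing {j} {k} g × Cycle H j (x ∘ g))

  NoConsecutiveEdge : ∀ k → (Fin k → V H) → Set
  NoConsecutiveEdge k x = ∀ i j l → CSucc k i j → CSucc k j l → ¬ IsEdge H (x i) (x j) (x l)

  ConsecutiveEdgeAt : ∀ k → (Fin k → V H) → Fin k → Set
  ConsecutiveEdgeAt k x d = ∀ a b → CSucc k a d → CSucc k d b → IsEdge H (x a) (x d) (x b)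

  TriangleCondition : ∀ k → (Fin k → V H) → Set
  TriangleCondition k x =
    k ≡ 3 → ∀ i j l → toℕ i ≡ 0 → toℕ j ≡ 1 → toℕ l ≡ 2 → ¬ IsEdge H (x i) (x j) (x l)

  noConsecutiveEdge⊎consecutiveEdgeAt : (x : Fin k → V H) →
    NoConsecutiveEdge k x ⊎ ∃ (ConsecutiveEdgeAt k x)
  noConsecutiveEdge⊎consecutiveEdgeAt {k} x
    with any? (λ a → any? (λ d → any? (λ b →
           csucc? k a d ×-dec csucc? k d b ×-dec isEdge? (x a) (x d) (x b))))
  ... | no ¬edge = inj₁ (λ i j l i→j j→l e → ¬edge (i , j , l , i→j , j→l , e))
  ... | yes (a₀ , d , b₀ , a₀→d , d→b₀ , e) = inj₂ (d , edgeAt)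
    where
    edgeAt : ConsecutiveEdgeAt k x d
    edgeAt a b a→d d→b
      rewrite CSucc-injective a→d a₀→d | CSucc-functional d→b d→b₀ = e

  subCycle-self : {x : Fin k → V H} → Cycle H k x → SubCycle k x
  subCycle-self c = _ , id , (λ _ _ a<b → a<b) , c

  subCycle-punchIn : (x : Fin (suc n) → V H) (d : Fin (suc n)) →
                     SubCycle n (x ∘ punchIn d) → SubCycle (suc n) x
  subCycle-punchIn x d (j , g , g-inc , c) =
    j , punchIn d ∘ g , (λ a b a<b → punchIn-strictlyIncreasing d _ _ (g-inc a b a<b)) , c

  -- The two neighbours of d remain adjacent through d.
  weakCycle-punchIn : {x : Fin (suc n) → V H} → WeakCycle H (suc n) x →
                      (d : Fin (suc n)) → ConsecutiveEdgeAt (suc n) x d → 3 ℕ.≤ n →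
                      TriangleCondition n (x ∘ punchIn d) → WeakCycle H n (x ∘ punchIn d)
  weakCycle-punchIn {x = x} (_ , x-inj , adjacent , _) d edgeAt 3≤n triangle =
    3≤n ,
    Comp.injective _≡_ _≡_ _≡_ (StrictlyIncreasing⇒Injective (punchIn-strictlyIncreasing d)) x-inj ,
    adjacent′ ,
    triangle
    where
    adjacent′ : ∀ i j → CSucc _ i j → Adjacent H (x (punchIn d i)) (x (punchIn d j))
    adjacent′ i j i→j with CSucc-punchIn d i→j
    ... | inj₁ i→j′           = adjacent _ _ i→j′
    ... | inj₂ (i→d , d→j) = x d , IsEdge-swap₂₃ (edgeAt _ _ i→d d→j)

  triangleCondition₃ : {y : Fin 3 → V H} → ¬ IsEdge H (y 0F) (y 1F) (y 2F) → TriangleCondition 3 y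
  triangleCondition₃ ¬e _ i j l i≡0 j≡1 l≡2
    rewrite toℕ-injective {i = i} {j = 0F} i≡0
          | toℕ-injective {i = j} {j = 1F} j≡1
          | toℕ-injective {i = l} {j = 2F} l≡2 = ¬e

  triangleCondition⊎edge : ∀ m (y : Fin (3 ℕ.+ m) → V H) →
                           TriangleCondition (3 ℕ.+ m) y ⊎ (m ≡ 0 × IsEdge H (y 0F) (y 1F) (y 2F))
  triangleCondition⊎edge (suc _) y = inj₁ (λ ())
  triangleCondition⊎edge zero    y with isEdge? (y 0F) (y 1F) (y 2F)
  ... | yes e  = inj₂ (refl , e)
  ... | no ¬e = inj₁ (triangleCondition₃ ¬e)

  weakCycle₃⇒cycle : {y : Fin 3 → V H} → WeakCycle H 3 y → Cycle H 3 y
  weakCycle₃⇒cycle {y} w@(_ , _ , _ , triangle) = inj₁ (w , noEdge)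
    where
    ¬e : ¬ IsEdge H (y 0F) (y 1F) (y 2F)
    ¬e = triangle refl 0F 1F 2F refl refl refl
    ¬rotatedEdge : ∀ i → ¬ IsEdge H (y i) (y (next₃ i)) (y (next₃ (next₃ i)))
    ¬rotatedEdge 0F = ¬e
    ¬rotatedEdge 1F = ¬e ∘ IsEdge-rotate ∘ IsEdge-rotate
    ¬rotatedEdge 2F = ¬e ∘ IsEdge-rotate
    noEdge : NoConsecutiveEdge 3 y
    noEdge i j l i→j j→l
      rewrite CSucc-functional j→l (CSucc-next₃ j)
            | CSucc-functional i→j (CSucc-next₃ i) = ¬rotatedEdge i

  subCycle-pair : {x : Fin k → V H} → Injective _≡_ _≡_ x → {i j : Fin k} → i < j →
                  ∀ {u v} → u ≢ v → IsEdge H (x i) (x j) u → IsEdge H (x i) (x j) v → SubCycle k x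
  subCycle-pair x-inj {i} {j} i<j {u} {v} u≢v eᵤ@((_ , xj≢u , xi≢u) , _) eᵥ@((_ , xj≢v , xi≢v) , _) =
    2 , pair i j , pair-inc , inj₂ (refl , x∘pair-inj , witnesses)
    where
    pair-inc = pair-strictlyIncreasing i<j
    x∘pair-inj = Comp.injective _≡_ _≡_ _≡_ (StrictlyIncreasing⇒Injective pair-inc) x-inj
    witnesses = λ { 0F 1F _ _ → u , v , u≢v , ≢-sym xi≢u , ≢-sym xj≢u , ≢-sym xi≢v , ≢-sym xj≢v , eᵤ , eᵥ
                  ; 0F 0F _ ()
                  ; 1F _ () _ }

  subCycle₄ : {x : Fin 4 → V H} → Injective _≡_ _≡_ x → (d : Fin 4) → ConsecutiveEdgeAt 4 x d →
              IsEdge H (x (punchIn d 0F)) (x (punchIn d 1F)) (x (punchIn d 2F)) → SubCycle 4 x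
  subCycle₄ x-inj 0F edgeAt e =
    subCycle-pair x-inj (s≤s (s≤s z≤n)) ((λ ()) ∘ x-inj)
      (IsEdge-rotate (IsEdge-rotate (edgeAt 3F 1F (inj₂ (refl , refl)) (inj₁ refl)))) (IsEdge-swap₂₃ e)
  subCycle₄ x-inj 1F edgeAt e =
    subCycle-pair x-inj (s≤s z≤n) ((λ ()) ∘ x-inj)
      (IsEdge-swap₂₃ (edgeAt 0F 2F (inj₁ refl) (inj₁ refl))) e
  subCycle₄ x-inj 2F edgeAt e =
    subCycle-pair x-inj (s≤s (s≤s z≤n)) ((λ ()) ∘ x-inj)
      (IsEdge-swap₂₃ (edgeAt 1F 3F (inj₁ refl) (inj₁ refl))) (IsEdge-rotate e)
  subCycle₄ x-inj 3F edgeAt e =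
    subCycle-pair x-inj (s≤s z≤n) ((λ ()) ∘ x-inj)
      (IsEdge-rotate (IsEdge-rotate (edgeAt 2F 0F (inj₁ refl) (inj₂ (refl , refl))))) (IsEdge-swap₂₃ e)

  -- Recursing under `with` would hide the decreasing length from the termination
  -- checker, so the induction hypothesis is passed in as an argument.
  weakCycle⇒subCycle-step : ∀ {m} (x : Fin (4 ℕ.+ m) → V H) → WeakCycle H (4 ℕ.+ m) x →
    (∀ y → WeakCycle H (3 ℕ.+ m) y → SubCycle (3 ℕ.+ m) y) → SubCycle (4 ℕ.+ m) x
  weakCycle⇒subCycle-step {m} x w@(_ , x-inj , _) induction
    with noConsecutiveEdge⊎consecutiveEdgeAt x
  ... | inj₁ noEdge = subCycle-self (inj₁ (w , noEdge))
  ... | inj₂ (d , edgeAt) with triangleCondition⊎edge m (x ∘ punchIn d)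
  ...   | inj₁ triangle = subCycle-punchIn x d (induction (x ∘ punchIn d)
                            (weakCycle-punchIn w d edgeAt (s≤s (s≤s (s≤s z≤n))) triangle))
  ...   | inj₂ (refl , e) = subCycle₄ x-inj d edgeAt e

  weakCycle⇒subCycle : ∀ k (x : Fin k → V H) → WeakCycle H k x → SubCycle k x
  weakCycle⇒subCycle 0 x (() , _)
  weakCycle⇒subCycle 1 x (s≤s () , _)
  weakCycle⇒subCycle 2 x (s≤s (s≤s ()) , _)
  weakCycle⇒subCycle 3 x w = subCycle-self (weakCycle₃⇒cycle w)
  weakCycle⇒subCycle (suc (suc (suc (suc m)))) x w =
    weakCycle⇒subCycle-step x w (weakCycle⇒subCycle (suc (suc (suc m))))

lemma2p2p1 : (∀ (H : Hypergraph) (k : ℕ) (x : Fin k → V H) → WeakCycle H k x →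
               ∃[ j ] ∃[ g ] (StrictlyIncreasing {j} {k} g × Cycle H j (x ∘ g)))
             × (∀ (H : Hypergraph) →
                 (∀ (j : ℕ) (y : Fin j → V H) → ¬ Cycle H j y) →
                 ∀ (k : ℕ) (x : Fin k → V H) → ¬ WeakCycle H k x)
lemma2p2p1 = weakCycle⇒subCycle , acyclic⇒noWeakCycle
  where
  acyclic⇒noWeakCycle : ∀ H → (∀ j (y : Fin j → V H) → ¬ Cycle H j y) →
                        ∀ k (x : Fin k → V H) → ¬ WeakCycle H k x
  acyclic⇒noWeakCycle H acyclic k x w =
    let (j , g , _ , c) = weakCycle⇒subCycle H k x w in acyclic j (x ∘ g) c
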